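{- Fix positive integers $k\leq n$. If $(\lambda,\varrho)\in\Theta(\mathsf{Broom}_{k,n}^\times)$, then $\mathtt{s}(\Omega(\lambda,\varrho))\in\Delta_{\mathrm{Weak}(\mathfrak S_n)}(w_{\circ}(k,n))$.
   Context: $\mathsf{Broom}_{k,n}$ is the rooted plane tree with vertices $0,1,\ldots,n$ in which vertex $i$ is the child of $i-1$ for $1\leq i\leq n-k$ and vertices $n-k+1,\ldots,n$ are the children of $n-k$; it is viewed as a poset $\leq$ with root $0$ as minimum and each non-root vertex covering its parent. $\mathsf{Broom}_{k,n}^\times$ is the forest poset on $[n]$ obtained by deleting $0$. An ornament is a subset of $[n]$ inducing a connected subgraph of $\mathsf{Broom}_{k,n}^\times$, hung at its minimal element; an ornamentation is a function $\varrho$ from $[n]$ to ornaments with $\varrho(v)$ hung at $v$ and any two values nested or disjoint. A linear extension is a permutation $\lambda$ of $[n]$ (one-line notation) in which $x<y$ in the tree order implies $x$ precedes $y$. $\Theta(\mathsf{Broom}_{k,n}^\times)$ is the set of pairs $(\lambda,\varrho)$ of a linear extension and an ornamentation such that each $\varrho(v)$ occupies consecutive positions of $\lambda$. For $(\lambda,\varrho)$ with $\lambda=w_1\cdots w_n$: $A_\varrho(u)=\{j\in[n]:u\in\varrho(n+1-j)\}$; $B_{(\lambda,\varrho)}(w_\ell)=A_\varrho(w_\ell)\setminus\bigcup_{i=\ell+1}^nA_\varrho(w_i)$; $\mu_{(\lambda,\varrho)}(w_\ell)$ lists $B_{(\lambda,\varrho)}(w_\ell)$ in decreasing order; $\Omega(\lambda,\varrho)=\mu_{(\lambda,\varrho)}(w_n)\cdots\mu_{(\lambda,\varrho)}(w_1)\in\mathfrak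 S_n$. An inversion of $w\in\mathfrak S_n$ is a pair $(i,j)$, $i<j$, with $j$ before $i$ in $w$; $\mathrm{Weak}(\mathfrak S_n)$ orders permutations by containment of inversion sets; $\Delta_{\mathrm{Weak}(\mathfrak S_n)}(w)=\{u: u\leq w\}$; $w_\circ(k,n)=k(k-1)\cdots1(k+1)\cdots n$. West's stack-sorting map: $\mathtt{s}(\epsilon)=\epsilon$, and for a word $\sigma=\mathsf{L}m\mathsf{R}$ with distinct letters and largest letter $m$, $\mathtt{s}(\sigma)=\mathtt{s}(\mathsf{L})\mathtt{s}(\mathsf{R})m$. -}

module Defs where

open import Data.Nat using (ℕ; zero; suc; _+_; _∸_; _≤_; _<_; _≤ᵇ_; _⊔_; _≟_)
import Data.Bool as B
open import Data.Bool using (Bool; true; false; if_then_else_; not)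
open import Data.List using (List; []; _∷_; _++_; [_]; map; filter; length; lookup; upTo; downFrom; span; drop; foldr)
open import Data.List.Relation.Binary.Permutation.Propositional using (_↭_)
open import Data.Bool.ListAction using (any)
open import Data.Fin as Fin using (Fin)
open import Data.Product using (Σ; _×_; ∃; ∃-syntax; proj₁; proj₂)
open import Data.Sum using (_⊎_)
open import Relation.Binary.PropositionalEquality using (_≡_; _≢_)
open import Relation.Nullary using (¬_)
open import Relation.Nullary.Decidable using (⌊_⌋; ¬?)

InRange : ℕ → ℕ → Set
InRange n x = 1 ≤ x × x ≤ n

oneTo : ℕ → List ℕ
oneTo n = map suc (upTo n)

Subset : Set
Subset = ℕ → Bool

_∈ₛ_ : ℕ → Subset → Set
x ∈ₛ S = S x ≡ true

-- The broom Broom_{k,n} on vertices 0,…,n (root 0)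

parent : (k n : ℕ) → ℕ → ℕ
parent k n i = if i ≤ᵇ (n ∸ k) then i ∸ 1 else n ∸ k

data TreeLeq (k n : ℕ) : ℕ → ℕ → Set where
  tle-refl : ∀ {x} → TreeLeq k n x x
  tle-step : ∀ {x y} → InRange n y → TreeLeq k n x (parent k n y) → TreeLeq k n x y

-- order of the forest Broom^×_{k,n}: restriction of the tree order to [n]
ForestLeq : (k n : ℕ) → ℕ → ℕ → Set
ForestLeq k n x y = InRange n x × InRange n y × TreeLeq k n x y

-- edges of the forest Broom^×_{k,n} (tree edges not touching the root 0)
ForestAdj : (k n : ℕ) → ℕ → ℕ → Set
ForestAdj k n a c =
  (InRange n c × InRange n a × a ≡ parent k n c) ⊎
  (InRange n a × InRange n c × c ≡ parent k n a)

data Walk (k n : ℕ) (S : Subset) : ℕ → ℕ → Set where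
  w-here : ∀ {a} → a ∈ₛ S → Walk k n S a a
  w-step : ∀ {a c b} → a ∈ₛ S → ForestAdj k n a c → Walk k n S c b → Walk k n S a b

IsOrnament : (k n : ℕ) → Subset → Set
IsOrnament k n S =
  (∀ x → x ∈ₛ S → InRange n x) ×
  (∃[ x ] x ∈ₛ S) ×
  (∀ a b → a ∈ₛ S → b ∈ₛ S → Walk k n S a b)

HungAt : (k n : ℕ) → Subset → ℕ → Set
HungAt k n S v = v ∈ₛ S × (∀ s → s ∈ₛ S → ForestLeq k n v s)

_⊆ₛ_ : Subset → Subset → Set
S ⊆ₛ T = ∀ x → x ∈ₛ S → x ∈ₛ T

Disjointₛ : Subset → Subset → Set
Disjointₛ S T = ∀ x → x ∈ₛ S → ¬ (x ∈ₛ T)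

-- an ornamentation (only its values on [n] matter)
IsOrnamentation : (k n : ℕ) → (ℕ → Subset) → Set
IsOrnamentation k n ρ =
  (∀ v → InRange n v → IsOrnament k n (ρ v) × HungAt k n (ρ v) v) ×
  (∀ u v → InRange n u → InRange n v →
     (ρ u ⊆ₛ ρ v) ⊎ (ρ v ⊆ₛ ρ u) ⊎ Disjointₛ (ρ u) (ρ v))

Precedes : List ℕ → ℕ → ℕ → Set
Precedes w x y =
  Σ (Fin (length w)) λ i → Σ (Fin (length w)) λ j →
    i Fin.< j × lookup w i ≡ x × lookup w j ≡ y

-- w is a permutation of [n] (one-line notation)
IsPerm : ℕ → List ℕ → Set
IsPerm n w = w ↭ oneTo n

IsLinearExtension : (k n : ℕ) → List ℕ → Set
IsLinearExtension k n λ′ =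
  IsPerm n λ′ × (∀ x y → ForestLeq k n x y → x ≢ y → Precedes λ′ x y)

OccupiesConsecutive : List ℕ → Subset → Set
OccupiesConsecutive w S =
  ∀ (i j l : Fin (length w)) → i Fin.< j → j Fin.< l →
    lookup w i ∈ₛ S → lookup w l ∈ₛ S → lookup w j ∈ₛ S

InTheta : (k n : ℕ) → List ℕ → (ℕ → Subset) → Set
InTheta k n λ′ ρ =
  IsLinearExtension k n λ′ × IsOrnamentation k n ρ ×
  (∀ v → InRange n v → OccupiesConsecutive λ′ (ρ v))

Alist : ℕ → (ℕ → Subset) → ℕ → List ℕ
Alist n ρ u = filter (λ j → ρ (suc n ∸ j) u B.≟ true) (map suc (downFrom n))

-- μ(w_ℓ) = B(w_ℓ) in decreasing order, where `rest` = w_{ℓ+1} ⋯ w_n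
mu : ℕ → (ℕ → Subset) → ℕ → List ℕ → List ℕ
mu n ρ u rest =
  filter (λ j → any (λ x → ρ (suc n ∸ j) x) rest B.≟ false) (Alist n ρ u)

OmegaAux : ℕ → (ℕ → Subset) → List ℕ → List ℕ
OmegaAux n ρ [] = []
OmegaAux n ρ (w ∷ rest) = OmegaAux n ρ rest ++ mu n ρ w rest

Omega : ℕ → List ℕ → (ℕ → Subset) → List ℕ
Omega n λ′ ρ = OmegaAux n ρ λ′

-- West's stack-sorting map  s(L m R) = s(L) s(R) m,  s(ε) = ε
-- (structural recursion on a fuel argument; fuel = length suffices,
--  since L and R are strictly shorter than L m R)

maxList : List ℕ → ℕ
maxList = foldr _⊔_ 0

stackSortFuel : ℕ → List ℕ → List ℕ
stackSortFuel zero σ = []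
stackSortFuel (suc f) [] = []
stackSortFuel (suc f) (x ∷ xs) =
  stackSortFuel f (proj₁ parts) ++ stackSortFuel f (drop 1 (proj₂ parts)) ++ [ m ]
  where
  m = maxList (x ∷ xs)
  parts = span (λ y → ¬? (y ≟ m)) (x ∷ xs)

stackSort : List ℕ → List ℕ
stackSort σ = stackSortFuel (length σ) σ

IsInversion : List ℕ → ℕ → ℕ → Set
IsInversion w i j = i < j × Precedes w j i

WeakLeq : ℕ → List ℕ → List ℕ → Set
WeakLeq n u w =
  IsPerm n u × IsPerm n w × (∀ i j → IsInversion u i j → IsInversion w i j)

wCirc : ℕ → ℕ → List ℕ
wCirc k n = map suc (downFrom k) ++ map (λ i → suc k + i) (upTo (n ∸ k))

-- Stack-sorting puts y before x (x < y) only if the input contains y, z, x in this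
-- order with y < z (a 231 pattern). In Ω(λ, ϱ) a letter j sits in the block of the
-- last entry of λ lying in ϱ(n+1-j), and blocks appear from the end of λ backwards.
-- If j > k, the vertices c < b < a mirroring z > j > i are comparable in the broom
-- (b lies on the handle 1, …, n - k), so λ lists c, b, a in this order; the 231
-- pattern then says ϱ(b) ends after ϱ(c) while ϱ(a) ends no later than ϱ(c). Hence
-- ϱ(c), an interval of λ, contains b, and none of the three laminar configurations
-- of ϱ(b) and ϱ(c) is possible. So every inversion (i, j) of s(Ω) has j ≤ k.
module Submission where

open import Defs
open import Data.Bool using (true; false; T) renaming (_≟_ to _≟ᵇ_)
open import Data.Bool.ListAction using (any)
open import Data.Empty using (⊥; ⊥-elim)
open import Data.Fin as Fin using (Fin; zero; suc)
import Data.Fin.Properties as Fin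
open import Data.List
  using (List; []; _∷_; _++_; [_]; length; lookup; drop; span; map; filter; upTo; downFrom)
open import Data.List.Properties using (length-++)
open import Data.List.Membership.Propositional using (_∈_)
open import Data.List.Membership.Propositional.Properties
  using (∈-lookup; ∈-++⁻; ∈-++⁺ˡ; ∈-++⁺ʳ; ∈-filter⁺; ∈-filter⁻; ∈-map⁺; ∈-map⁻;
         ∈-upTo⁺; ∈-upTo⁻; ∈-downFrom⁺; ∈-downFrom⁻)
open import Data.List.Membership.Propositional.Properties.WithK using (unique∧set⇒bag)
open import Data.List.Relation.Binary.BagAndSetEquality using (∼bag⇒↭)
open import Data.List.Relation.Binary.Permutation.Propositional
  using (_↭_; ↭-refl; ↭-sym; ↭-trans; ↭⇒↭ₛ; module PermutationReasoning)
import Data.List.Relation.Binary.Permutation.Propositional.Properties as ↭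
import Data.List.Relation.Binary.Permutation.Setoid.Properties as ↭ₛ
import Data.List.Relation.Unary.All as All
open import Data.List.Relation.Unary.AllPairs using ([]; _∷_)
open import Data.List.Relation.Unary.Any as Any using (here; there)
open import Data.List.Relation.Unary.Any.Properties using (lookup-index)
open import Data.List.Relation.Unary.Unique.Propositional using (Unique)
import Data.List.Relation.Unary.Unique.Propositional.Properties as Unique
open import Data.Nat
  using (ℕ; zero; suc; _+_; _∸_; _≤_; _<_; _≤ᵇ_; _≡ᵇ_; _≟_; _≤?_; z≤n; s≤s; s≤s⁻¹)
open import Data.Nat.Properties
open import Data.Product using (∃; ∃₂; ∃-syntax; _×_; _,_; proj₁; proj₂)
open import Data.Sum using (_⊎_; inj₁; inj₂; [_,_]′)
import Data.Sum as Sum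
open import Data.Unit using (tt)
open import Function.Base using (id)
open import Function.Bundles using (mk⇔)
open import Relation.Binary.PropositionalEquality
  using (_≡_; _≢_; refl; sym; trans; cong; subst; subst₂; setoid)
open import Relation.Nullary using (does; yes; no; ¬_; ¬?)
open import Relation.Unary using (Decidable)

private
  variable
    A : Set
    x y z : A
    xs ys : List A

data Before {A : Set} : List A → A → A → Set where
  at-head : y ∈ xs → Before (x ∷ xs) x y
  in-tail : Before xs x y → Before (z ∷ xs) x y

Before-∈ˡ : Before xs x y → x ∈ xs
Before-∈ˡ (at-head _) = here refl
Before-∈ˡ (in-tail b) = there (Before-∈ˡ b)

Before-∈ʳ : Before xs x y → y ∈ xs
Before-∈ʳ (at-head y∈) = there y∈
Before-∈ʳ (in-tail b) = there (Before-∈ʳ b)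

Precedes⇒Before : ∀ {x y} ws → Precedes ws x y → Before ws x y
Precedes⇒Before (_ ∷ ws) (zero , suc j , _ , refl , refl) = at-head (∈-lookup j)
Precedes⇒Before (_ ∷ ws) (suc i , suc j , s≤s i<j , p , q) =
  in-tail (Precedes⇒Before ws (i , j , i<j , p , q))

Before⇒Precedes : ∀ {ws x y} → Before ws x y → Precedes ws x y
Before⇒Precedes (at-head y∈) =
  zero , suc (Any.index y∈) , s≤s z≤n , refl , sym (lookup-index y∈)
Before⇒Precedes (in-tail b) =
  let i , j , i<j , p , q = Before⇒Precedes b in suc i , suc j , s≤s i<j , p , q

Before-++⁺ˡ : ∀ ys → Before xs x y → Before (xs ++ ys) x y
Before-++⁺ˡ ys (at-head y∈) = at-head (∈-++⁺ˡ y∈)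
Before-++⁺ˡ ys (in-tail b) = in-tail (Before-++⁺ˡ ys b)

Before-++⁺ʳ : ∀ xs → Before ys x y → Before (xs ++ ys) x y
Before-++⁺ʳ [] b = b
Before-++⁺ʳ (_ ∷ xs) b = in-tail (Before-++⁺ʳ xs b)

Before-++⁺ : x ∈ xs → y ∈ ys → Before (xs ++ ys) x y
Before-++⁺ {xs = _ ∷ xs} (here refl) y∈ = at-head (∈-++⁺ʳ xs y∈)
Before-++⁺ (there x∈) y∈ = in-tail (Before-++⁺ x∈ y∈)

Before-++⁻ : ∀ xs → Before (xs ++ ys) x y →
  Before xs x y ⊎ (x ∈ xs × y ∈ ys) ⊎ Before ys x y
Before-++⁻ [] b = inj₂ (inj₂ b)
Before-++⁻ (_ ∷ xs) (at-head y∈) with ∈-++⁻ xs y∈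
... | inj₁ y∈xs = inj₁ (at-head y∈xs)
... | inj₂ y∈ys = inj₂ (inj₁ (here refl , y∈ys))
Before-++⁻ (_ ∷ xs) (in-tail b) with Before-++⁻ xs b
... | inj₁ b′ = inj₁ (in-tail b′)
... | inj₂ (inj₁ (x∈ , y∈)) = inj₂ (inj₁ (there x∈ , y∈))
... | inj₂ (inj₂ b′) = inj₂ (inj₂ b′)

Before-filter⁻ : ∀ {P : A → Set} (P? : Decidable P) xs →
  Before (filter P? xs) x y → Before xs x y
Before-filter⁻ P? (x ∷ xs) b with does (P? x)
... | false = in-tail (Before-filter⁻ P? xs b)
Before-filter⁻ P? (x ∷ xs) (at-head y∈) | true = at-head (proj₁ (∈-filter⁻ P? y∈))
Before-filter⁻ P? (x ∷ xs) (in-tail b) | true = in-tail (Before-filter⁻ P? xs b)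

lookup-injective : Unique xs → ∀ {i j} → lookup xs i ≡ lookup xs j → i ≡ j
lookup-injective {xs = _ ∷ _} _ {zero} {zero} _ = refl
lookup-injective {xs = _ ∷ _} (x∉ ∷ _) {zero} {suc j} eq = ⊥-elim (All.lookup x∉ (∈-lookup j) eq)
lookup-injective {xs = _ ∷ _} (x∉ ∷ _) {suc i} {zero} eq =
  ⊥-elim (All.lookup x∉ (∈-lookup i) (sym eq))
lookup-injective {xs = _ ∷ _} (_ ∷ u) {suc i} {suc j} eq = cong suc (lookup-injective u eq)

maxList-upper : ∀ xs → x ∈ xs → x ≤ maxList xs
maxList-upper (y ∷ ys) (here refl) = m≤m⊔n y (maxList ys)
maxList-upper (y ∷ ys) (there x∈) = ≤-trans (maxList-upper ys x∈) (m≤n⊔m y (maxList ys))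

maxList-∈ : ∀ y ys → maxList (y ∷ ys) ∈ y ∷ ys
maxList-∈ y [] rewrite ⊔-identityʳ y = here refl
maxList-∈ y (y′ ∷ ys) with ⊔-sel y (maxList (y′ ∷ ys))
... | inj₁ eq = here eq
... | inj₂ eq = there (subst (_∈ y′ ∷ ys) (sym eq) (maxList-∈ y′ ys))

≡ᵇ-false⇒≢ : ∀ {m n} → (m ≡ᵇ n) ≡ false → m ≢ n
≡ᵇ-false⇒≢ {m} m≢ᵇn refl = subst T m≢ᵇn (≡⇒≡ᵇ m m refl)

-- Split on x ≡ᵇ m rather than x ≟ m: span only computes once the test (x ≟ m)
-- has been reduced to the boolean x ≡ᵇ m it is built from.
span-≢ : ∀ m xs → m ∈ xs → ∃₂ λ L R →
  span (λ y → ¬? (y ≟ m)) xs ≡ (L , m ∷ R) × xs ≡ L ++ m ∷ R × (∀ {y} → y ∈ L → y ≢ m)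
span-≢ m (x ∷ xs) m∈ with x ≡ᵇ m in x≡ᵇm
... | true with ≡ᵇ⇒≡ x m (subst T (sym x≡ᵇm) tt)
...   | refl = [] , xs , refl , refl , λ ()
span-≢ m (x ∷ xs) (here refl) | false = ⊥-elim (≡ᵇ-false⇒≢ {m} x≡ᵇm refl)
span-≢ m (x ∷ xs) (there m∈) | false =
  let L , R , sp , eq , L≢m = span-≢ m xs m∈ in
  x ∷ L , R , cong (λ (L′ , R′) → x ∷ L′ , R′) sp , cong (x ∷_) eq ,
  λ { (here refl) → ≡ᵇ-false⇒≢ x≡ᵇm ; (there y∈) → L≢m y∈ }

stackSortFuel-split : ∀ f y ys → let m = maxList (y ∷ ys) in ∃₂ λ L R →
  stackSortFuel (suc f) (y ∷ ys) ≡ stackSortFuel f L ++ stackSortFuel f R ++ [ m ] ×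
  y ∷ ys ≡ L ++ m ∷ R × (∀ {x} → x ∈ L → x ≢ m)
stackSortFuel-split f y ys with span-≢ (maxList (y ∷ ys)) (y ∷ ys) (maxList-∈ y ys)
... | L , R , sp , eq , L≢m =
  L , R , cong (λ LmR → stackSortFuel f (proj₁ LmR) ++ stackSortFuel f (drop 1 (proj₂ LmR))
                         ++ [ maxList (y ∷ ys) ]) sp ,
  eq , L≢m

stackSortFuel-⊆ : ∀ f σ → x ∈ stackSortFuel f σ → x ∈ σ
stackSortFuel-⊆ {x = x} (suc f) (a ∷ as) x∈ with stackSortFuel-split f a as
... | L , R , s≡ , σ≡ , _ =
  subst (x ∈_) (sym σ≡) (from-parts (∈-++⁻ (stackSortFuel f L) (subst (x ∈_) s≡ x∈)))
  where
  m : ℕ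
  m = maxList (a ∷ as)
  from-parts : x ∈ stackSortFuel f L ⊎ x ∈ stackSortFuel f R ++ [ m ] → x ∈ L ++ m ∷ R
  from-parts (inj₁ x∈L) = ∈-++⁺ˡ (stackSortFuel-⊆ f L x∈L)
  from-parts (inj₂ x∈Rm) with ∈-++⁻ (stackSortFuel f R) x∈Rm
  ... | inj₁ x∈R = ∈-++⁺ʳ L (there (stackSortFuel-⊆ f R x∈R))
  ... | inj₂ (here refl) = ∈-++⁺ʳ L (here refl)

stackSortFuel-↭ : ∀ f σ → length σ ≤ f → stackSortFuel f σ ↭ σ
stackSortFuel-↭ zero [] _ = ↭-refl
stackSortFuel-↭ (suc f) [] _ = ↭-refl
stackSortFuel-↭ (suc f) (a ∷ as) (s≤s |as|≤f) with stackSortFuel-split f a as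
... | L , R , s≡ , σ≡ , _ = begin
  stackSortFuel (suc f) (a ∷ as)          ≡⟨ s≡ ⟩
  stackSortFuel f L ++ stackSortFuel f R ++ [ m ]
    ↭⟨ ↭.++⁺ (stackSortFuel-↭ f L |L|≤f) (↭.++⁺ʳ [ m ] (stackSortFuel-↭ f R |R|≤f)) ⟩
  L ++ R ++ [ m ]                          ↭⟨ ↭.++⁺ˡ L (↭.++-comm R [ m ]) ⟩
  L ++ m ∷ R                               ≡⟨ sym σ≡ ⟩
  a ∷ as                                   ∎
  where
  open PermutationReasoning
  m : ℕ
  m = maxList (a ∷ as)
  |as|≡ : length as ≡ length L + length R
  |as|≡ = suc-injective
    (trans (cong length σ≡) (trans (length-++ L) (+-suc (length L) (length R))))
  |L|≤f : length L ≤ f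
  |L|≤f = ≤-trans (m≤m+n (length L) (length R)) (subst (_≤ f) |as|≡ |as|≤f)
  |R|≤f : length R ≤ f
  |R|≤f = ≤-trans (m≤n+m (length R) (length L)) (subst (_≤ f) |as|≡ |as|≤f)

stackSortFuel-231 : ∀ f σ → x < y → Before (stackSortFuel f σ) y x →
  ∃[ z ] y < z × Before σ y z × Before σ z x
stackSortFuel-231 {x = x} {y = y} (suc f) (a ∷ as) x<y b with stackSortFuel-split f a as
... | L , R , s≡ , σ≡ , L≢m =
  from-parts (Before-++⁻ (stackSortFuel f L) (subst (λ ws → Before ws y x) s≡ b))
  where
  m : ℕ
  m = maxList (a ∷ as)
  into-σ : ∀ {u v} → Before (L ++ m ∷ R) u v → Before (a ∷ as) u v
  into-σ = subst (λ ws → Before ws _ _) (sym σ≡)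
  ≤m : ∀ {u} → u ∈ L ++ m ∷ R → u ≤ m
  ≤m u∈ = maxList-upper (a ∷ as) (subst (_ ∈_) (sym σ≡) u∈)
  x≢m : y ∈ L ++ m ∷ R → x ≢ m
  x≢m y∈ refl = <⇒≱ x<y (≤m y∈)
  y∈ˡ : y ∈ stackSortFuel f L → y ∈ L ++ m ∷ R
  y∈ˡ y∈ = ∈-++⁺ˡ (stackSortFuel-⊆ f L y∈)
  y∈ʳ : y ∈ stackSortFuel f R → y ∈ L ++ m ∷ R
  y∈ʳ y∈ = ∈-++⁺ʳ L (there (stackSortFuel-⊆ f R y∈))
  from-parts : Before (stackSortFuel f L) y x ⊎
               (y ∈ stackSortFuel f L × x ∈ stackSortFuel f R ++ [ m ]) ⊎
               Before (stackSortFuel f R ++ [ m ]) y x →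
               ∃[ z ] y < z × Before (a ∷ as) y z × Before (a ∷ as) z x
  from-parts (inj₁ b) =
    let z , y<z , yz , zx = stackSortFuel-231 f L x<y b in
    z , y<z , into-σ (Before-++⁺ˡ (m ∷ R) yz) , into-σ (Before-++⁺ˡ (m ∷ R) zx)
  from-parts (inj₂ (inj₁ (y∈ , x∈))) with ∈-++⁻ (stackSortFuel f R) x∈
  ... | inj₁ x∈R =
    m , ≤∧≢⇒< (≤m (y∈ˡ y∈)) (L≢m (stackSortFuel-⊆ f L y∈)) ,
    into-σ (Before-++⁺ (stackSortFuel-⊆ f L y∈) (here refl)) ,
    into-σ (Before-++⁺ʳ L (at-head (stackSortFuel-⊆ f R x∈R)))
  ... | inj₂ (here x≡m) = ⊥-elim (x≢m (y∈ˡ y∈) x≡m)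
  from-parts (inj₂ (inj₂ b)) with Before-++⁻ (stackSortFuel f R) b
  ... | inj₁ b′ =
    let z , y<z , yz , zx = stackSortFuel-231 f R x<y b′ in
    z , y<z , into-σ (Before-++⁺ʳ L (in-tail yz)) , into-σ (Before-++⁺ʳ L (in-tail zx))
  ... | inj₂ (inj₁ (y∈ , here x≡m)) = ⊥-elim (x≢m (y∈ʳ y∈) x≡m)
  ... | inj₂ (inj₂ (at-head ()))
  ... | inj₂ (inj₂ (in-tail ()))

stackSort-⊆ : ∀ σ → x ∈ stackSort σ → x ∈ σ
stackSort-⊆ σ = stackSortFuel-⊆ (length σ) σ

stackSort-231 : ∀ σ → x < y → Before (stackSort σ) y x →
  ∃[ z ] y < z × Before σ y z × Before σ z x
stackSort-231 σ = stackSortFuel-231 (length σ) σ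

stackSort-↭ : ∀ σ → stackSort σ ↭ σ
stackSort-↭ σ = stackSortFuel-↭ (length σ) σ ≤-refl

record IsLastIn (ws : List ℕ) (S : Subset) (e : Fin (length ws)) : Set where
  constructor lastAt
  field
    entry∈ : lookup ws e ∈ₛ S
    maximal : ∀ i → lookup ws i ∈ₛ S → i Fin.≤ e
open IsLastIn

module _ {S : Subset} where

  any-false⇒∉ : ∀ ws → any S ws ≡ false → ∀ i → ¬ lookup ws i ∈ₛ S
  any-false⇒∉ (w ∷ ws) none zero w∈ with S w
  any-false⇒∉ (w ∷ ws) () zero w∈ | true
  any-false⇒∉ (w ∷ ws) none zero () | false
  any-false⇒∉ (w ∷ ws) none (suc i) i∈ with S w
  any-false⇒∉ (w ∷ ws) () (suc i) i∈ | true
  ... | false = any-false⇒∉ ws none i i∈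

  any-true⇒∈ : ∀ ws → any S ws ≡ true → ∃[ i ] lookup ws i ∈ₛ S
  any-true⇒∈ (w ∷ ws) some with S w in Sw
  ... | true = zero , Sw
  ... | false = let i , i∈ = any-true⇒∈ ws some in suc i , i∈

  IsLastIn-unique : ∀ {ws e e′} → IsLastIn ws S e → IsLastIn ws S e′ → e ≡ e′
  IsLastIn-unique (lastAt e∈ e-last) (lastAt e′∈ e′-last) =
    Fin.≤-antisym (e′-last _ e∈) (e-last _ e′∈)

  IsLastIn-∷⁺ : ∀ {w ws e} → IsLastIn ws S e → IsLastIn (w ∷ ws) S (suc e)
  IsLastIn-∷⁺ (lastAt e∈ e-last) = lastAt e∈ λ { zero _ → z≤n ; (suc i) i∈ → s≤s (e-last i i∈) }

  IsLastIn-∷⁻ : ∀ {w ws e} → IsLastIn (w ∷ ws) S (suc e) → IsLastIn ws S e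
  IsLastIn-∷⁻ (lastAt e∈ e-last) = lastAt e∈ λ i i∈ → s≤s⁻¹ (e-last (suc i) i∈)

  IsLastIn-head⁺ : ∀ {w} ws → w ∈ₛ S → any S ws ≡ false → IsLastIn (w ∷ ws) S zero
  IsLastIn-head⁺ ws w∈ none =
    lastAt w∈ λ { zero _ → z≤n ; (suc i) i∈ → ⊥-elim (any-false⇒∉ ws none i i∈) }

  IsLastIn-head⁻ : ∀ {w ws} → IsLastIn (w ∷ ws) S zero → any S ws ≡ false
  IsLastIn-head⁻ {ws = ws} (lastAt _ zero-last) with any S ws in some
  ... | false = refl
  ... | true with zero-last (suc (proj₁ (any-true⇒∈ ws some))) (proj₂ (any-true⇒∈ ws some))
  ...   | ()

  IsLastIn-exists : ∀ ws i → lookup ws i ∈ₛ S → ∃ (IsLastIn ws S)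
  IsLastIn-exists (w ∷ ws) i i∈ with any S ws in some
  ... | true = let j , j∈ = any-true⇒∈ ws some ; e , last = IsLastIn-exists ws j j∈ in
               suc e , IsLastIn-∷⁺ last
  IsLastIn-exists (w ∷ ws) zero i∈ | false = zero , IsLastIn-head⁺ ws i∈ some
  IsLastIn-exists (w ∷ ws) (suc i) i∈ | false = ⊥-elim (any-false⇒∉ ws some i i∈)

-- The entry at j lies in T since T occupies an interval; so only S ⊆ T is possible.
IsLastIn-≤-laminar : ∀ {ws S T e e′} →
  (S ⊆ₛ T) ⊎ (T ⊆ₛ S) ⊎ Disjointₛ S T → OccupiesConsecutive ws T →
  ∀ i j l → i Fin.< j → j Fin.< l →
  lookup ws i ∈ₛ T → lookup ws l ∈ₛ T → ¬ lookup ws i ∈ₛ S → lookup ws j ∈ₛ S →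
  IsLastIn ws S e → IsLastIn ws T e′ → e Fin.≤ e′
IsLastIn-≤-laminar (inj₁ S⊆T) _ _ _ _ _ _ _ _ _ _ S-last T-last =
  maximal T-last _ (S⊆T _ (entry∈ S-last))
IsLastIn-≤-laminar (inj₂ (inj₁ T⊆S)) _ _ _ _ _ _ i∈T _ i∉S _ _ _ = ⊥-elim (i∉S (T⊆S _ i∈T))
IsLastIn-≤-laminar (inj₂ (inj₂ S∩T≡∅)) interval i j l i<j j<l i∈T l∈T _ j∈S _ _ =
  ⊥-elim (S∩T≡∅ _ j∈S (interval i j l i<j j<l i∈T l∈T))

∈-descending⁻ : ∀ n → y ∈ map suc (downFrom n) → InRange n y
∈-descending⁻ n y∈ with ∈-map⁻ suc y∈
... | _ , x∈ , refl = s≤s z≤n , ∈-downFrom⁻ x∈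

Before-descending⁻ : ∀ n → Before (map suc (downFrom n)) y z → z < y
Before-descending⁻ (suc n) (at-head z∈) = s≤s (proj₂ (∈-descending⁻ n z∈))
Before-descending⁻ (suc n) (in-tail b) = Before-descending⁻ n b

∈-descending⁺ : ∀ {n} → InRange n y → y ∈ map suc (downFrom n)
∈-descending⁺ {suc y} (_ , y≤n) = ∈-map⁺ suc (∈-downFrom⁺ y≤n)

Before-descending⁺ : ∀ k {i j} → 1 ≤ i → i < j → j ≤ k → Before (map suc (downFrom k)) j i
Before-descending⁺ (suc k) {suc i} {j} _ i<j j≤ with j ≟ suc k
... | yes refl = at-head (∈-descending⁺ (s≤s z≤n , s≤s⁻¹ i<j))
... | no j≢ = in-tail (Before-descending⁺ k (s≤s z≤n) i<j (s≤s⁻¹ (≤∧≢⇒< j≤ j≢)))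
Before-descending⁺ zero {suc i} {suc j} _ _ ()

module OmegaAux-Properties (n : ℕ) (ρ : ℕ → Subset) where

  -- j ∈ A_ϱ(u) iff u ∈ₛ O j
  O : ℕ → Subset
  O j = ρ (suc n ∸ j)

  ∈-mu⁻ : ∀ {w} ws {j} → j ∈ mu n ρ w ws →
    w ∈ₛ O j × any (O j) ws ≡ false × j ∈ map suc (downFrom n)
  ∈-mu⁻ {w} ws j∈ =
    let j∈A , none = ∈-filter⁻ (λ j → any (O j) ws ≟ᵇ false) j∈
        j∈desc , w∈ = ∈-filter⁻ (λ j → O j w ≟ᵇ true) j∈A
    in w∈ , none , j∈desc

  ∈-mu⁺ : ∀ {w} ws {j} → j ∈ map suc (downFrom n) → w ∈ₛ O j → any (O j) ws ≡ false →
    j ∈ mu n ρ w ws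
  ∈-mu⁺ {w} ws j∈desc w∈ none =
    ∈-filter⁺ (λ j → any (O j) ws ≟ᵇ false)
      (∈-filter⁺ (λ j → O j w ≟ᵇ true) j∈desc w∈) none

  Before-mu⁻ : ∀ {w} ws → Before (mu n ρ w ws) y z → z < y
  Before-mu⁻ _ b = Before-descending⁻ n (Before-filter⁻ _ _ (Before-filter⁻ _ _ b))

  ∈-OmegaAux⁻ : ∀ ws → y ∈ OmegaAux n ρ ws → ∃ (IsLastIn ws (O y)) × InRange n y
  ∈-OmegaAux⁻ (w ∷ ws) y∈ with ∈-++⁻ (OmegaAux n ρ ws) y∈
  ... | inj₁ y∈Ω = let (e , last) , y∈[n] = ∈-OmegaAux⁻ ws y∈Ω in
                   (suc e , IsLastIn-∷⁺ last) , y∈[n]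
  ... | inj₂ y∈μ = let w∈ , none , y∈desc = ∈-mu⁻ ws y∈μ in
                   (zero , IsLastIn-head⁺ ws w∈ none) , ∈-descending⁻ n y∈desc

  ∈-OmegaAux⁺ : ∀ ws {j e} → j ∈ map suc (downFrom n) → IsLastIn ws (O j) e →
    j ∈ OmegaAux n ρ ws
  ∈-OmegaAux⁺ (w ∷ ws) {e = zero} j∈desc last =
    ∈-++⁺ʳ (OmegaAux n ρ ws) (∈-mu⁺ ws j∈desc (entry∈ last) (IsLastIn-head⁻ last))
  ∈-OmegaAux⁺ (w ∷ ws) {e = suc e} j∈desc last =
    ∈-++⁺ˡ (∈-OmegaAux⁺ ws j∈desc (IsLastIn-∷⁻ last))

  Before-OmegaAux⇒∃IsLastIn : ∀ ws → Before (OmegaAux n ρ ws) y z → ∃₂ λ e e′ →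
    IsLastIn ws (O y) e × IsLastIn ws (O z) e′ × (e′ Fin.< e ⊎ e′ ≡ e × z < y)
  Before-OmegaAux⇒∃IsLastIn (w ∷ ws) b with Before-++⁻ (OmegaAux n ρ ws) b
  ... | inj₁ b′ =
    let e , e′ , y-last , z-last , order = Before-OmegaAux⇒∃IsLastIn ws b′ in
    suc e , suc e′ , IsLastIn-∷⁺ y-last , IsLastIn-∷⁺ z-last ,
    Sum.map s≤s (λ (e′≡e , z<y) → cong suc e′≡e , z<y) order
  ... | inj₂ (inj₁ (y∈Ω , z∈μ)) =
    let (e , y-last) , _ = ∈-OmegaAux⁻ ws y∈Ω ; w∈ , none , _ = ∈-mu⁻ ws z∈μ in
    suc e , zero , IsLastIn-∷⁺ y-last , IsLastIn-head⁺ ws w∈ none , inj₁ (s≤s z≤n)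
  ... | inj₂ (inj₂ b′) =
    let w∈ , none , _ = ∈-mu⁻ ws (Before-∈ˡ b′) ; w∈′ , none′ , _ = ∈-mu⁻ ws (Before-∈ʳ b′) in
    zero , zero , IsLastIn-head⁺ ws w∈ none , IsLastIn-head⁺ ws w∈′ none′ ,
    inj₂ (refl , Before-mu⁻ ws b′)

  Before-OmegaAux⁻ : ∀ ws {e e′} → Before (OmegaAux n ρ ws) y z →
    IsLastIn ws (O y) e → IsLastIn ws (O z) e′ → e′ Fin.< e ⊎ e′ ≡ e × z < y
  Before-OmegaAux⁻ {y = y} {z = z} ws b y-last z-last =
    let _ , _ , y-last₀ , z-last₀ , order = Before-OmegaAux⇒∃IsLastIn ws b in
    subst₂ (λ e e′ → e′ Fin.< e ⊎ e′ ≡ e × z < y)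
      (IsLastIn-unique y-last₀ y-last) (IsLastIn-unique z-last₀ z-last) order

  OmegaAux-unique : ∀ ws → Unique (OmegaAux n ρ ws)
  OmegaAux-unique [] = []
  OmegaAux-unique (w ∷ ws) =
    Unique.++⁺ (OmegaAux-unique ws)
      (Unique.filter⁺ _ (Unique.filter⁺ _ (Unique.map⁺ suc-injective (Unique.downFrom⁺ n))))
      (λ (v∈Ω , v∈μ) →
        let (e , v-last) , _ = ∈-OmegaAux⁻ ws v∈Ω ; _ , none , _ = ∈-mu⁻ ws v∈μ in
        any-false⇒∉ ws none e (entry∈ v-last))

module Broom (k n : ℕ) where

  parent-handle : ∀ {y} → y ≤ n ∸ k → parent k n y ≡ y ∸ 1
  parent-handle {y} y≤ with y ≤ᵇ (n ∸ k) in y≤ᵇ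
  ... | true = refl
  ... | false = ⊥-elim (subst T y≤ᵇ (≤⇒≤ᵇ y≤))

  parent-bristle : ∀ {y} → n ∸ k < y → parent k n y ≡ n ∸ k
  parent-bristle {y} y> with y ≤ᵇ (n ∸ k) in y≤ᵇ
  ... | true = ⊥-elim (<⇒≱ y> (≤ᵇ⇒≤ y (n ∸ k) (subst T (sym y≤ᵇ) tt)))
  ... | false = refl

  parent-≤ : ∀ y → parent k n y ≤ y
  parent-≤ y with y ≤? n ∸ k
  ... | yes y≤ = subst (_≤ y) (sym (parent-handle y≤)) (m∸n≤m y 1)
  ... | no y≰ = subst (_≤ y) (sym (parent-bristle (≰⇒> y≰))) (<⇒≤ (≰⇒> y≰))

  TreeLeq⇒≤ : ∀ {x y} → TreeLeq k n x y → x ≤ y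
  TreeLeq⇒≤ tle-refl = ≤-refl
  TreeLeq⇒≤ (tle-step {y = y} _ x≤py) = ≤-trans (TreeLeq⇒≤ x≤py) (parent-≤ y)

  TreeLeq-handle : ∀ {x} y → x ≤ y → y ≤ n ∸ k → TreeLeq k n x y
  TreeLeq-handle zero z≤n _ = tle-refl
  TreeLeq-handle {x} (suc y) x≤ y≤ with x ≟ suc y
  ... | yes refl = tle-refl
  ... | no x≢ = tle-step (s≤s z≤n , ≤-trans y≤ (m∸n≤m n k))
      (subst (TreeLeq k n x) (sym (parent-handle y≤))
        (TreeLeq-handle y (s≤s⁻¹ (≤∧≢⇒< x≤ x≢)) (≤-trans (n≤1+n y) y≤)))

  ForestLeq-handle : ∀ {x y} → 1 ≤ x → x ≤ n ∸ k → x ≤ y → y ≤ n → ForestLeq k n x y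
  ForestLeq-handle {x} {y} 1≤x x≤ x≤y y≤n =
    (1≤x , ≤-trans x≤ (m∸n≤m n k)) , (≤-trans 1≤x x≤y , y≤n) , x≤y-in-tree
    where
    x≤y-in-tree : TreeLeq k n x y
    x≤y-in-tree with y ≤? n ∸ k
    ... | yes y≤ = TreeLeq-handle y x≤y y≤
    ... | no y≰ = tle-step (≤-trans 1≤x x≤y , y≤n)
        (subst (TreeLeq k n x) (sym (parent-bristle (≰⇒> y≰))) (TreeLeq-handle (n ∸ k) x≤ ≤-refl))

module _ {n : ℕ} where

  ∈-oneTo⁻ : y ∈ oneTo n → InRange n y
  ∈-oneTo⁻ y∈ with ∈-map⁻ suc y∈
  ... | _ , x∈ , refl = s≤s z≤n , ∈-upTo⁻ x∈

  ∈-oneTo⁺ : InRange n y → y ∈ oneTo n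
  ∈-oneTo⁺ {suc y} (_ , y<n) = ∈-map⁺ suc (∈-upTo⁺ y<n)

  oneTo-unique : Unique (oneTo n)
  oneTo-unique = Unique.map⁺ suc-injective (Unique.upTo⁺ n)

  ↭-oneTo : Unique xs → (∀ {y} → y ∈ xs → InRange n y) → (∀ {y} → InRange n y → y ∈ xs) →
    xs ↭ oneTo n
  ↭-oneTo xs-unique ⊆[n] [n]⊆ = ∼bag⇒↭ (unique∧set⇒bag xs-unique oneTo-unique
    (mk⇔ (λ y∈ → ∈-oneTo⁺ (⊆[n] y∈)) (λ y∈ → [n]⊆ (∈-oneTo⁻ y∈))))

  ↭-oneTo⇒unique : xs ↭ oneTo n → Unique xs
  ↭-oneTo⇒unique xs↭ = ↭ₛ.Unique-resp-↭ (setoid ℕ) (↭⇒↭ₛ (↭-sym xs↭)) oneTo-unique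

  mirror-InRange : InRange n x → InRange n (suc n ∸ x)
  mirror-InRange {suc x} (_ , x≤n) = m<n⇒0<n∸m (s≤s x≤n) , m∸n≤m n x

  mirror-< : x < y → y ≤ n → suc n ∸ y < suc n ∸ x
  mirror-< x<y y≤n = ∸-monoʳ-< x<y (m≤n⇒m≤1+n y≤n)

  mirror-handle : ∀ {k} → k < y → suc n ∸ y ≤ n ∸ k
  mirror-handle k<y = ∸-monoʳ-≤ (suc n) k<y

module _ (k n : ℕ) (k≤n : k ≤ n) where

  wCirc-∈⁻ : y ∈ wCirc k n → InRange n y
  wCirc-∈⁻ y∈ with ∈-++⁻ (map suc (downFrom k)) y∈
  ... | inj₁ y∈desc = let 1≤y , y≤k = ∈-descending⁻ k y∈desc in 1≤y , ≤-trans y≤k k≤n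
  ... | inj₂ y∈asc with ∈-map⁻ (suc k +_) y∈asc
  ...   | d , d∈ , refl = s≤s z≤n , (begin
    suc k + d    ≡⟨ +-suc k d ⟨
    k + suc d    ≤⟨ +-monoʳ-≤ k (∈-upTo⁻ d∈) ⟩
    k + (n ∸ k)  ≡⟨ m+[n∸m]≡n k≤n ⟩
    n            ∎)
    where open ≤-Reasoning

  wCirc-∈⁺ : InRange n y → y ∈ wCirc k n
  wCirc-∈⁺ {y} y∈[n] with y ≤? k
  ... | yes y≤k = ∈-++⁺ˡ (∈-descending⁺ (proj₁ y∈[n] , y≤k))
  ... | no y≰k with m≤n⇒∃[o]m+o≡n (≰⇒> y≰k)
  ...   | d , refl = ∈-++⁺ʳ (map suc (downFrom k)) (∈-map⁺ (suc k +_) (∈-upTo⁺ (begin-strict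
    d                  ≡⟨ m+n∸m≡n (suc k) d ⟨
    suc k + d ∸ suc k  <⟨ ∸-monoˡ-< (s≤s (proj₂ y∈[n])) (m≤m+n (suc k) d) ⟩
    suc n ∸ suc k      ∎)))
    where open ≤-Reasoning

  wCirc-unique : Unique (wCirc k n)
  wCirc-unique = Unique.++⁺
    (Unique.map⁺ suc-injective (Unique.downFrom⁺ k))
    (Unique.map⁺ (+-cancelˡ-≡ (suc k) _ _) (Unique.upTo⁺ (n ∸ k)))
    (λ (y∈desc , y∈asc) →
      let _ , d∈ , y≡ = ∈-map⁻ (suc k +_) y∈asc in
      <⇒≱ (subst (k <_) (sym y≡) (s≤s (m≤m+n k _))) (proj₂ (∈-descending⁻ k y∈desc)))

  wCirc-↭ : wCirc k n ↭ oneTo n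
  wCirc-↭ = ↭-oneTo wCirc-unique wCirc-∈⁻ wCirc-∈⁺

module _ {k n : ℕ} {λ′ : List ℕ} {ρ : ℕ → Subset}
         (λ′-linear : IsLinearExtension k n λ′) (ϱ-orn : IsOrnamentation k n ρ)
         (ϱ-intervals : ∀ v → InRange n v → OccupiesConsecutive λ′ (ρ v)) where

  open OmegaAux-Properties n ρ
  open Broom k n

  hung : ∀ {v} → InRange n v → HungAt k n (ρ v) v
  hung v∈[n] = proj₂ (proj₁ ϱ-orn _ v∈[n])

  last-≤-of-straddled : ∀ {a b c ea eb ec} → InRange n a → InRange n b → InRange n c →
    Precedes λ′ c b → Precedes λ′ b a → ¬ c ∈ₛ ρ b →
    IsLastIn λ′ (ρ a) ea → IsLastIn λ′ (ρ b) eb → IsLastIn λ′ (ρ c) ec →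
    ea Fin.≤ ec → eb Fin.≤ ec
  last-≤-of-straddled {ec = ec} a∈[n] b∈[n] c∈[n]
    (pc , pb , pc<pb , refl , refl) (pb′ , pa , pb′<pa , b≡ , refl) c∉ρb a-last b-last c-last ea≤ec =
    IsLastIn-≤-laminar (proj₂ ϱ-orn _ _ b∈[n] c∈[n]) (ϱ-intervals _ c∈[n])
      pc pb ec pc<pb pb<ec (proj₁ (hung c∈[n])) (entry∈ c-last) c∉ρb (proj₁ (hung b∈[n]))
      b-last c-last
    where
    pb≡pb′ : pb ≡ pb′
    pb≡pb′ = lookup-injective (↭-oneTo⇒unique (proj₁ λ′-linear)) (sym b≡)
    pb<ec : pb Fin.< ec
    pb<ec = <-≤-trans (subst (Fin._< pa) (sym pb≡pb′) pb′<pa)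
              (≤-trans (maximal a-last pa (proj₁ (hung a∈[n]))) ea≤ec)

  last-≤-on-handle : ∀ {a b c ea eb ec} → InRange n c → c < b → b ≤ n ∸ k → b < a → InRange n a →
    IsLastIn λ′ (ρ a) ea → IsLastIn λ′ (ρ b) eb → IsLastIn λ′ (ρ c) ec →
    ea Fin.≤ ec → eb Fin.≤ ec
  last-≤-on-handle {a} {b} {c} c∈[n] c<b b≤ b<a a∈[n] =
    last-≤-of-straddled a∈[n] b∈[n] c∈[n]
      (proj₂ λ′-linear c b c≤b (<⇒≢ c<b)) (proj₂ λ′-linear b a b≤a (<⇒≢ b<a)) c∉ρb
    where
    b∈[n] : InRange n b
    b∈[n] = ≤-trans (proj₁ c∈[n]) (<⇒≤ c<b) , ≤-trans (<⇒≤ b<a) (proj₂ a∈[n])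
    c≤b : ForestLeq k n c b
    c≤b = ForestLeq-handle (proj₁ c∈[n]) (≤-trans (<⇒≤ c<b) b≤) (<⇒≤ c<b) (proj₂ b∈[n])
    b≤a : ForestLeq k n b a
    b≤a = ForestLeq-handle (proj₁ b∈[n]) b≤ (<⇒≤ b<a) (proj₂ a∈[n])
    c∉ρb : ¬ c ∈ₛ ρ b
    c∉ρb c∈ρb = <⇒≱ c<b (TreeLeq⇒≤ (proj₂ (proj₂ (proj₂ (hung b∈[n]) c c∈ρb))))

  Omega-↭ : OmegaAux n ρ λ′ ↭ oneTo n
  Omega-↭ = ↭-oneTo (OmegaAux-unique λ′) (λ j∈ → proj₂ (∈-OmegaAux⁻ λ′ j∈)) complete
    where
    complete : ∀ {j} → InRange n j → j ∈ OmegaAux n ρ λ′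
    complete {j} j∈[n] =
      let v∈[n] = mirror-InRange j∈[n]
          v∈λ′ = ↭.Any-resp-↭ (↭-sym (proj₁ λ′-linear)) (∈-oneTo⁺ v∈[n])
          _ , last = IsLastIn-exists λ′ (Any.index v∈λ′)
                       (subst (_∈ₛ O j) (lookup-index v∈λ′) (proj₁ (hung v∈[n])))
      in ∈-OmegaAux⁺ λ′ (∈-descending⁺ j∈[n]) last

  Omega-no-231-above : ∀ {i j z} → k < j → i < j → j < z →
    Before (OmegaAux n ρ λ′) j z → Before (OmegaAux n ρ λ′) z i → ⊥
  Omega-no-231-above k<j i<j j<z jz zi =
    let (_ , b-last) , j∈[n] = ∈-OmegaAux⁻ λ′ (Before-∈ˡ jz)
        (_ , c-last) , z∈[n] = ∈-OmegaAux⁻ λ′ (Before-∈ʳ jz)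
        (_ , a-last) , i∈[n] = ∈-OmegaAux⁻ λ′ (Before-∈ʳ zi)
        ec<eb = [ id , (λ (_ , z<j) → ⊥-elim (<-asym z<j j<z)) ]′
                  (Before-OmegaAux⁻ λ′ jz b-last c-last)
        ea≤ec = [ <⇒≤ , (λ (ea≡ec , _) → Fin.≤-reflexive ea≡ec) ]′
                  (Before-OmegaAux⁻ λ′ zi c-last a-last)
    in <⇒≱ ec<eb (last-≤-on-handle (mirror-InRange z∈[n]) (mirror-< j<z (proj₂ z∈[n]))
                    (mirror-handle k<j) (mirror-< i<j (proj₂ j∈[n])) (mirror-InRange i∈[n])
                    a-last b-last c-last ea≤ec)

  stackSort-Omega-inversion : ∀ {i j} → i < j → Before (stackSort (OmegaAux n ρ λ′)) j i → j ≤ k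
  stackSort-Omega-inversion {j = j} i<j ji with j ≤? k
  ... | yes j≤k = j≤k
  ... | no j≰k =
    let _ , j<z , jz , zi = stackSort-231 (OmegaAux n ρ λ′) i<j ji in
    ⊥-elim (Omega-no-231-above (≰⇒> j≰k) i<j j<z jz zi)

lemma7p4 : (k n : ℕ) → 1 ≤ k → k ≤ n →
    (λ′ : List ℕ) (ρ : ℕ → Subset) → InTheta k n λ′ ρ →
    WeakLeq n (stackSort (Omega n λ′ ρ)) (wCirc k n)
lemma7p4 k n _ k≤n λ′ ρ (λ′-linear , ϱ-orn , ϱ-intervals) =
  ↭-trans (stackSort-↭ Ω) (Omega-↭ λ′-linear ϱ-orn ϱ-intervals) , wCirc-↭ k n k≤n , inversion
  where
  Ω : List ℕ
  Ω = Omega n λ′ ρ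
  inversion : ∀ i j → IsInversion (stackSort Ω) i j → IsInversion (wCirc k n) i j
  inversion i j (i<j , j≺i) =
    let ji = Precedes⇒Before _ j≺i
        1≤i = proj₁ (∈-oneTo⁻ (↭.∈-resp-↭ (Omega-↭ λ′-linear ϱ-orn ϱ-intervals)
                                  (stackSort-⊆ Ω (Before-∈ʳ ji))))
        j≤k = stackSort-Omega-inversion λ′-linear ϱ-orn ϱ-intervals i<j ji
    in i<j , Before⇒Precedes (Before-++⁺ˡ _ (Before-descending⁺ k 1≤i i<j j≤k))
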